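{- Let $(\alpha,\beta,\gamma)\in\mathbb{Z}[i]^3$ satisfy $\alpha^2+\beta^2+\gamma^2=0$, $\alpha\beta\gamma\neq0$ and $\gcd(\alpha,\beta,\gamma)\in U$. Suppose $\alpha=i^m\alpha'$, $\beta=i^n(1+i)^{2+k}\beta'$, $\gamma=i^l\gamma'$, where $m,n,l\in\{0,1\}$, $k\ge 0$ is an integer, and $\alpha',\beta',\gamma'\in O^I$. Then $m+l\equiv 1\pmod 2$.
   Context: $\mathbb{Z}[i]$ is the ring of Gaussian integers and $U=\{1,-1,i,-i\}$ its unit group. For $\alpha\in\mathbb{Z}[i]$, $R(\alpha)$ and $I(\alpha)$ denote its real and imaginary parts. $O^I=\{\alpha\in\mathbb{Z}[i]: R(\alpha)+I(\alpha)\equiv 1 \pmod 2,\ R(\alpha)\equiv 1 \pmod 4\}$. "$\gcd(\alpha,\beta,\gamma)\in U$" means $\alpha,\beta,\gamma$ have no common non-unit divisor. -}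

module Defs where

open import Data.Integer as ℤ using (ℤ; +_; -[1+_])
open import Data.Nat as ℕ using (ℕ; zero; suc)
open import Data.Product using (Σ; ∃; _×_; _,_)
open import Data.Sum using (_⊎_)
open import Relation.Binary.PropositionalEquality using (_≡_)
open import Relation.Nullary using (¬_)

record ℤ[i] : Set where
  constructor _+_i
  field
    re : ℤ
    im : ℤ
open ℤ[i] public

R : ℤ[i] → ℤ
R = re

I : ℤ[i] → ℤ
I = im

0G : ℤ[i]
0G = (+ 0) + (+ 0) i

1G : ℤ[i]
1G = (+ 1) + (+ 0) i

iG : ℤ[i]
iG = (+ 0) + (+ 1) i

_+G_ : ℤ[i] → ℤ[i] → ℤ[i]
(a + b i) +G (c + d i) = (a ℤ.+ c) + (b ℤ.+ d) i

_*G_ : ℤ[i] → ℤ[i] → ℤ[i]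
(a + b i) *G (c + d i) = (a ℤ.* c ℤ.- b ℤ.* d) + (a ℤ.* d ℤ.+ b ℤ.* c) i

infixl 6 _+G_
infixl 7 _*G_

_^G_ : ℤ[i] → ℕ → ℤ[i]
x ^G zero = 1G
x ^G suc n = x *G (x ^G n)

infixr 8 _^G_

1+iG : ℤ[i]
1+iG = (+ 1) + (+ 1) i

_∣G_ : ℤ[i] → ℤ[i] → Set
δ ∣G α = ∃ λ κ → α ≡ κ *G δ

U : ℤ[i] → Set
U u = (u ≡ (+ 1) + (+ 0) i) ⊎ (u ≡ (-[1+ 0 ]) + (+ 0) i)
    ⊎ (u ≡ (+ 0) + (+ 1) i) ⊎ (u ≡ (+ 0) + (-[1+ 0 ]) i)

-- gcd(α,β,γ) ∈ U : every common divisor is a unit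
GcdInU : ℤ[i] → ℤ[i] → ℤ[i] → Set
GcdInU α β γ = ∀ δ → δ ∣G α → δ ∣G β → δ ∣G γ → U δ

_≡_[mod_] : ℤ → ℤ → ℤ → Set
a ≡ b [mod n ] = ∃ λ t → a ℤ.- b ≡ t ℤ.* n

OI : ℤ[i] → Set
OI α = ((R α ℤ.+ I α) ≡ (+ 1) [mod (+ 2) ]) × (R α ≡ (+ 1) [mod (+ 4) ])

{-# OPTIONS --safe #-}
module Submission where

-- Compare real parts of the squares modulo 4. An element of O^I squares to 1 (mod 4), and
-- β is divisible by (1 + i)² = 2i, so its square has real part divisible by 4. Since
-- (i^m)² = ±1, the equation α² + β² + γ² = 0 reads ±1 ± 1 ≡ 0 (mod 4) on real parts,
-- which forces the two signs, i.e. the parities of m and l, to differ.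

open import Defs
open import Data.Nat using (ℕ; suc; _≤_; _+_; _%_; s≤s)
open import Data.Nat.Divisibility using (∣⇒≤)
open import Data.Product using (Σ; _,_)
open import Data.Integer as ℤ using (ℤ; +_)
open import Data.Integer.Divisibility.Signed using (_∣_; divides; ∣⇒∣ᵤ; ∣m⇒∣-m; ∣m∣n⇒∣m+n; ∣m∣n⇒∣m-n)
open import Data.Integer.Tactic.RingSolver using (solve-∀)
open import Relation.Binary.PropositionalEquality
  using (_≡_; _≢_; refl; sym; trans; cong; cong₂; subst; module ≡-Reasoning)

open ≡-Reasoning

Even : ℤ[i] → Set
Even z = Σ ℤ λ x → Σ ℤ λ y → z ≡ (+ 2 ℤ.* x) + (+ 2 ℤ.* y) i

*G-comm : ∀ z w → z *G w ≡ w *G z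
*G-comm (a + b i) (c + d i) = cong₂ _+_i (re-comm a b c d) (im-comm a b c d)
  where
  re-comm : ∀ a b c d → a ℤ.* c ℤ.- b ℤ.* d ≡ c ℤ.* a ℤ.- d ℤ.* b
  re-comm = solve-∀
  im-comm : ∀ a b c d → a ℤ.* d ℤ.+ b ℤ.* c ≡ c ℤ.* b ℤ.+ d ℤ.* a
  im-comm = solve-∀

Even-*ˡ : ∀ u z → Even z → Even (u *G z)
Even-*ˡ (p + q i) _ (x , y , refl) =
  p ℤ.* x ℤ.- q ℤ.* y , p ℤ.* y ℤ.+ q ℤ.* x , cong₂ _+_i (re-half p q x y) (im-half p q x y)
  where
  re-half : ∀ p q x y → p ℤ.* (+ 2 ℤ.* x) ℤ.- q ℤ.* (+ 2 ℤ.* y) ≡ + 2 ℤ.* (p ℤ.* x ℤ.- q ℤ.* y)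
  re-half = solve-∀
  im-half : ∀ p q x y → p ℤ.* (+ 2 ℤ.* y) ℤ.+ q ℤ.* (+ 2 ℤ.* x) ≡ + 2 ℤ.* (p ℤ.* y ℤ.+ q ℤ.* x)
  im-half = solve-∀

Even-*ʳ : ∀ z u → Even z → Even (z *G u)
Even-*ʳ z u even-z = subst Even (*G-comm u z) (Even-*ˡ u z even-z)

-- (1 + i)² = 2i
Even-1+i*1+i* : ∀ w → Even (1+iG *G (1+iG *G w))
Even-1+i*1+i* (c + d i) = ℤ.- d , c , cong₂ _+_i (re-half c d) (im-half c d)
  where
  re-half : ∀ c d → + 1 ℤ.* (+ 1 ℤ.* c ℤ.- + 1 ℤ.* d) ℤ.- + 1 ℤ.* (+ 1 ℤ.* d ℤ.+ + 1 ℤ.* c)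
                    ≡ + 2 ℤ.* (ℤ.- d)
  re-half = solve-∀
  im-half : ∀ c d → + 1 ℤ.* (+ 1 ℤ.* d ℤ.+ + 1 ℤ.* c) ℤ.+ + 1 ℤ.* (+ 1 ℤ.* c ℤ.- + 1 ℤ.* d)
                    ≡ + 2 ℤ.* c
  im-half = solve-∀

Even⇒4∣re[z²] : ∀ z → Even z → + 4 ∣ re (z *G z)
Even⇒4∣re[z²] _ (x , y , refl) = divides (x ℤ.* x ℤ.- y ℤ.* y) (quarter x y)
  where
  quarter : ∀ x y → (+ 2 ℤ.* x) ℤ.* (+ 2 ℤ.* x) ℤ.- (+ 2 ℤ.* y) ℤ.* (+ 2 ℤ.* y)
                    ≡ (x ℤ.* x ℤ.- y ℤ.* y) ℤ.* + 4
  quarter = solve-∀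

OI⇒4∣re[z²]-1 : ∀ z → OI z → + 4 ∣ re (z *G z) ℤ.- + 1
OI⇒4∣re[z²]-1 (a + b i) ((t , a+b-1≡2t) , (s , a-1≡4s)) =
  divides (+ 2 ℤ.* s ℤ.+ + 4 ℤ.* s ℤ.* t ℤ.- t ℤ.* t) (begin
    a ℤ.* a ℤ.- b ℤ.* b ℤ.- + 1
      ≡⟨ via-residues a b ⟩
    + 2 ℤ.* (a ℤ.- + 1) ℤ.+ + 2 ℤ.* (a ℤ.- + 1) ℤ.* (a ℤ.+ b ℤ.- + 1) ℤ.- (a ℤ.+ b ℤ.- + 1) ℤ.* (a ℤ.+ b ℤ.- + 1)
      ≡⟨ cong₂ (λ x y → + 2 ℤ.* x ℤ.+ + 2 ℤ.* x ℤ.* y ℤ.- y ℤ.* y) a-1≡4s a+b-1≡2t ⟩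
    + 2 ℤ.* (s ℤ.* + 4) ℤ.+ + 2 ℤ.* (s ℤ.* + 4) ℤ.* (t ℤ.* + 2) ℤ.- (t ℤ.* + 2) ℤ.* (t ℤ.* + 2)
      ≡⟨ collect s t ⟩
    (+ 2 ℤ.* s ℤ.+ + 4 ℤ.* s ℤ.* t ℤ.- t ℤ.* t) ℤ.* + 4 ∎)
  where
  via-residues : ∀ a b → a ℤ.* a ℤ.- b ℤ.* b ℤ.- + 1
    ≡ + 2 ℤ.* (a ℤ.- + 1) ℤ.+ + 2 ℤ.* (a ℤ.- + 1) ℤ.* (a ℤ.+ b ℤ.- + 1) ℤ.- (a ℤ.+ b ℤ.- + 1) ℤ.* (a ℤ.+ b ℤ.- + 1)
  via-residues = solve-∀
  collect : ∀ s t → + 2 ℤ.* (s ℤ.* + 4) ℤ.+ + 2 ℤ.* (s ℤ.* + 4) ℤ.* (t ℤ.* + 2) ℤ.- (t ℤ.* + 2) ℤ.* (t ℤ.* + 2)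
    ≡ (+ 2 ℤ.* s ℤ.+ + 4 ℤ.* s ℤ.* t ℤ.- t ℤ.* t) ℤ.* + 4
  collect = solve-∀

re[[i⁰*z]²]≡re[z²] : ∀ z → re ((iG ^G 0 *G z) *G (iG ^G 0 *G z)) ≡ re (z *G z)
re[[i⁰*z]²]≡re[z²] (a + b i) = unchanged a b
  where
  unchanged : ∀ a b → (+ 1 ℤ.* a ℤ.- + 0 ℤ.* b) ℤ.* (+ 1 ℤ.* a ℤ.- + 0 ℤ.* b)
                      ℤ.- (+ 1 ℤ.* b ℤ.+ + 0 ℤ.* a) ℤ.* (+ 1 ℤ.* b ℤ.+ + 0 ℤ.* a)
                      ≡ a ℤ.* a ℤ.- b ℤ.* b
  unchanged = solve-∀

re[[i¹*z]²]≡-re[z²] : ∀ z → re ((iG ^G 1 *G z) *G (iG ^G 1 *G z)) ≡ ℤ.- re (z *G z)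
re[[i¹*z]²]≡-re[z²] (a + b i) = negated a b
  where
  negated : ∀ a b → (+ 0 ℤ.* a ℤ.- + 1 ℤ.* b) ℤ.* (+ 0 ℤ.* a ℤ.- + 1 ℤ.* b)
                    ℤ.- (+ 0 ℤ.* b ℤ.+ + 1 ℤ.* a) ℤ.* (+ 0 ℤ.* b ℤ.+ + 1 ℤ.* a)
                    ≡ ℤ.- (a ℤ.* a ℤ.- b ℤ.* b)
  negated = solve-∀

OI⇒4∣re[[i^m*z]²]-re[i^m*i^m] : ∀ z m → m ≤ 1 → OI z →
  + 4 ∣ re ((iG ^G m *G z) *G (iG ^G m *G z)) ℤ.- re (iG ^G m *G iG ^G m)
OI⇒4∣re[[i^m*z]²]-re[i^m*i^m] z 0 _ z∈OI =
  subst (λ x → + 4 ∣ x ℤ.- + 1) (sym (re[[i⁰*z]²]≡re[z²] z)) (OI⇒4∣re[z²]-1 z z∈OI)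
OI⇒4∣re[[i^m*z]²]-re[i^m*i^m] z 1 _ z∈OI =
  subst (+ 4 ∣_) (trans (negate (re (z *G z))) (cong (ℤ._- ℤ.- + 1) (sym (re[[i¹*z]²]≡-re[z²] z))))
    (∣m⇒∣-m (OI⇒4∣re[z²]-1 z z∈OI))
  where
  negate : ∀ x → ℤ.- (x ℤ.- + 1) ≡ ℤ.- x ℤ.- ℤ.- + 1
  negate = solve-∀
OI⇒4∣re[[i^m*z]²]-re[i^m*i^m] _ (suc (suc _)) (s≤s ()) _

4∣re[i^m*i^m]+re[i^l*i^l]⇒m+l-odd : ∀ {m l} → m ≤ 1 → l ≤ 1 →
  + 4 ∣ re (iG ^G m *G iG ^G m) ℤ.+ re (iG ^G l *G iG ^G l) → (m + l) % 2 ≡ 1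
4∣re[i^m*i^m]+re[i^l*i^l]⇒m+l-odd {0} {0} _ _ 4∣2 with ∣⇒≤ (∣⇒∣ᵤ 4∣2)
... | s≤s (s≤s ())
4∣re[i^m*i^m]+re[i^l*i^l]⇒m+l-odd {0} {1} _ _ _ = refl
4∣re[i^m*i^m]+re[i^l*i^l]⇒m+l-odd {1} {0} _ _ _ = refl
4∣re[i^m*i^m]+re[i^l*i^l]⇒m+l-odd {1} {1} _ _ 4∣-2 with ∣⇒≤ (∣⇒∣ᵤ 4∣-2)
... | s≤s (s≤s ())
4∣re[i^m*i^m]+re[i^l*i^l]⇒m+l-odd {suc (suc _)} (s≤s ()) _ _
4∣re[i^m*i^m]+re[i^l*i^l]⇒m+l-odd {_} {suc (suc _)} _ (s≤s ()) _

lemma4p2 : (α β γ α′ β′ γ′ : ℤ[i]) (m n l k : ℕ) →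
    α *G α +G β *G β +G γ *G γ ≡ 0G →
    α *G β *G γ ≢ 0G →
    GcdInU α β γ →
    m ≤ 1 → n ≤ 1 → l ≤ 1 →
    α ≡ iG ^G m *G α′ →
    β ≡ iG ^G n *G 1+iG ^G (2 + k) *G β′ →
    γ ≡ iG ^G l *G γ′ →
    OI α′ → OI β′ → OI γ′ →
    (m + l) % 2 ≡ 1
lemma4p2 α β γ α′ β′ γ′ m n l k sum≡0 _ _ m≤1 _ l≤1 refl refl refl α′∈OI _ γ′∈OI =
  4∣re[i^m*i^m]+re[i^l*i^l]⇒m+l-odd m≤1 l≤1
    (subst (+ 4 ∣_) (cancel (re (α *G α)) (re (β *G β)) (re (γ *G γ)) _ _)
      (∣m∣n⇒∣m-n 4∣sum (∣m∣n⇒∣m+n (∣m∣n⇒∣m+n 4∣α²-i^2m 4∣β²) 4∣γ²-i^2l)))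
  where
  4∣sum : + 4 ∣ re (α *G α) ℤ.+ re (β *G β) ℤ.+ re (γ *G γ)
  4∣sum = subst (+ 4 ∣_) (sym (cong re sum≡0)) (divides (+ 0) refl)
  4∣α²-i^2m : + 4 ∣ re (α *G α) ℤ.- re (iG ^G m *G iG ^G m)
  4∣α²-i^2m = OI⇒4∣re[[i^m*z]²]-re[i^m*i^m] α′ m m≤1 α′∈OI
  4∣β² : + 4 ∣ re (β *G β)
  4∣β² = Even⇒4∣re[z²] β (Even-*ʳ _ β′ (Even-*ˡ (iG ^G n) _ (Even-1+i*1+i* (1+iG ^G k))))
  4∣γ²-i^2l : + 4 ∣ re (γ *G γ) ℤ.- re (iG ^G l *G iG ^G l)
  4∣γ²-i^2l = OI⇒4∣re[[i^m*z]²]-re[i^m*i^m] γ′ l l≤1 γ′∈OI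
  cancel : ∀ A B C a c → A ℤ.+ B ℤ.+ C ℤ.- ((A ℤ.- a) ℤ.+ B ℤ.+ (C ℤ.- c)) ≡ a ℤ.+ c
  cancel = solve-∀
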